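{- If $\boldsymbol{A}$ is a monomorphic tower of countable abelian groups, then $\varprojlim^1\boldsymbol{A}$ and $\varprojlim^1\boldsymbol{A}^{\mathrm{fil}}$ are definably isomorphic.
   Context: A tower of countable abelian groups $\boldsymbol{A}=(A^{(m)},p^{(m,m+1)})_{m\in\omega}$ consists of countable abelian groups and homomorphisms $p^{(m,m+1)}:A^{(m+1)}\to A^{(m)}$; it is monomorphic if every $p^{(m,m+1)}$ is injective, in which case, up to isomorphism of towers, one may take $A^{(0)}\supseteq A^{(1)}\supseteq\cdots$ with inclusions as bonding maps. With $A^{(\infty)}:=\bigcap_m A^{(m)}$, $\boldsymbol{A}^{\mathrm{fil}}$ is the tower $(A^{(m)}/A^{(\infty)})_m$ with inclusion bonding maps. For a tower of abelian groups with bonding maps $p^{(m_0,m_1)}$ (composites), $\mathrm{Z}(\boldsymbol{A})\subseteq\prod_{m_0\leq m_1}A^{(m_0)}$ (product of discrete groups) is the closed subgroup of $(x_{m_0,m_1})$ with $x_{m_0,m_2}=x_{m_0,m_1}+p^{(m_0,m_1)}(x_{m_1,m_2})$ for all $m_0\leq m_1\leq m_2$; $\mathrm{B}(\boldsymbol{A})$ is the Polishable subgroup of those of the form $x_{m_0,m_1}=z_{m_0}-p^{(m_0,m_1)}(z_{m_1})$ for some $(z_m)\in\prod_mA^{(m)}$; $\varprojlim^1\boldsymbol{A}$ is the group with a Polish cover $\mathrm{Z}(\boldsymbol{A})/\mathrm{B}(\boldsymbol{A})$. Groups with a Polish cover $G/N$, $G'/N'$ are definably isomorphic if there is a group isomorphism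 between them admitting a Borel lift $G\to G'$. -}

module Defs where

open import Level using (0ℓ)
open import Data.Nat using (ℕ; _≤_; suc)
open import Data.Nat.Properties using (≤-trans)
open import Data.Product using (Σ; _×_; _,_; proj₁; proj₂)
open import Relation.Nullary using (¬_)
open import Algebra.Bundles using (AbelianGroup)

-- Borel sets / Borel maps on a product  ∏_{i : I} C  of discrete
-- countable spaces, where the discrete space C is given by a carrier
-- together with an equivalence relation _~_ (its points are the
-- ~-classes).  The Borel σ-algebra is generated by the preimages
-- {x | x i ∈ S} of arbitrary subsets S of the discrete factor
-- (i.e. all (cl)open subsets of a coordinate), closed under
-- complements, countable unions, countable intersections, and
-- extensional equality of subsets.

module _ {I C : Set} (_~_ : C → C → Set) where

  Respects : (C → Set) → Set
  Respects S = ∀ {a b} → a ~ b → S a → S b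

  data IsBorel : ((I → C) → Set) → Set₁ where
    gen   : (i : I) (S : C → Set) → Respects S → IsBorel (λ x → S (x i))
    compl : ∀ {P} → IsBorel P → IsBorel (λ x → ¬ P x)
    union : (P : ℕ → (I → C) → Set) → (∀ n → IsBorel (P n)) →
            IsBorel (λ x → Σ ℕ λ n → P n x)
    inter : (P : ℕ → (I → C) → Set) → (∀ n → IsBorel (P n)) →
            IsBorel (λ x → ∀ n → P n x)
    ext   : ∀ {P Q} → (∀ x → P x → Q x) → (∀ x → Q x → P x) →
            IsBorel P → IsBorel Q

IsBorelMap : {I J C D : Set} (_~C_ : C → C → Set) (_~D_ : D → D → Set) →
             ((I → C) → (J → D)) → Set₁
IsBorelMap {I = I} {J = J} {D = D} _~C_ _~D_ F =
  (j : J) (S : D → Set) → Respects {I = J} _~D_ S → IsBorel {I = I} _~C_ (λ x → S (F x j))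

-- Countable abelian groups and monomorphic towers (as decreasing chains
-- of subgroups A⁽⁰⁾ ⊇ A⁽¹⁾ ⊇ ⋯ of a countable abelian group G).

module _ (G : AbelianGroup 0ℓ 0ℓ) where
  open AbelianGroup G

  Countable : Set
  Countable = Σ (ℕ → Carrier) λ e → ∀ g → Σ ℕ λ n → e n ≈ g

  record IsSubgroup (H : Carrier → Set) : Set where
    field
      resp  : ∀ {a b} → a ≈ b → H a → H b
      has-ε : H ε
      ∙-cl  : ∀ {a b} → H a → H b → H (a ∙ b)
      ⁻¹-cl : ∀ {a} → H a → H (a ⁻¹)

  record IsMonoTower (A : ℕ → Carrier → Set) : Set where
    field
      subgroup   : ∀ m → IsSubgroup (A m)
      decreasing : ∀ m {a} → A (suc m) a → A m a

  A∞ : (ℕ → Carrier → Set) → Carrier → Set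
  A∞ A a = ∀ m → A m a

  -- equality in A⁽ᵐ⁾/A⁽∞⁾ on representatives
  _≈[_]∞_ : Carrier → (ℕ → Carrier → Set) → Carrier → Set
  a ≈[ A ]∞ b = A∞ A (a ∙ b ⁻¹)

  Idx : Set
  Idx = Σ (ℕ × ℕ) λ p → proj₁ p ≤ proj₂ p

  -- points of ∏_{m₀ ≤ m₁} A⁽ᵐ⁰⁾ (coordinates as representatives in G)
  Pt : Set
  Pt = Idx → Carrier

  at : Pt → ∀ {m₀ m₁} → m₀ ≤ m₁ → Carrier
  at x {m₀} {m₁} p = x ((m₀ , m₁) , p)

  _⊕_ : Pt → Pt → Pt
  (x ⊕ y) i = x i ∙ y i

  ⊖_ : Pt → Pt
  (⊖ x) i = (x i) ⁻¹

  -- Z and B of the tower of subgroups A, where the coordinate groups are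
  -- A⁽ᵐ⁾ modulo the (congruence) relation _~_ : for 𝑨 itself _~_ = _≈_,
  -- for 𝑨^fil _~_ = _≈[ A ]∞_ (coordinate group A⁽ᵐ⁾/A⁽∞⁾).
  -- Bonding maps are the (induced) inclusions.
  Z : (ℕ → Carrier → Set) → (Carrier → Carrier → Set) → Pt → Set
  Z A _~_ x =
    (∀ {m₀ m₁} (p : m₀ ≤ m₁) → A m₀ (at x p)) ×
    (∀ {m₀ m₁ m₂} (p : m₀ ≤ m₁) (q : m₁ ≤ m₂) →
       at x (≤-trans p q) ~ (at x p ∙ at x q))

  B : (ℕ → Carrier → Set) → (Carrier → Carrier → Set) → Pt → Set
  B A _~_ x = Σ (ℕ → Carrier) λ z → (∀ m → A m (z m)) ×
    (∀ {m₀ m₁} (p : m₀ ≤ m₁) → at x p ~ (z m₀ ∙ (z m₁) ⁻¹))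

  -- Z(𝑨)/B(𝑨) and Z(𝑨')/B(𝑨') (coordinate relations _~_, _~'_) are
  -- definably isomorphic: there is a group isomorphism between the
  -- quotients with a Borel lift F, written out on representatives.
  DefinablyIsomorphic : (ℕ → Carrier → Set) → (Carrier → Carrier → Set) →
                        (ℕ → Carrier → Set) → (Carrier → Carrier → Set) → Set₁
  DefinablyIsomorphic A _~_ A' _~'_ =
    Σ (Pt → Pt) λ F →
      IsBorelMap _~_ _~'_ F ×
      (∀ x → Z A _~_ x → Z A' _~'_ (F x)) ×
      (∀ x y → Z A _~_ x → Z A _~_ y → B A _~_ (x ⊕ (⊖ y)) →
         B A' _~'_ (F x ⊕ (⊖ F y))) ×
      (∀ x y → Z A _~_ x → Z A _~_ y →
         B A' _~'_ (F (x ⊕ y) ⊕ (⊖ (F x ⊕ F y)))) ×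
      (∀ x → Z A _~_ x → B A' _~'_ (F x) → B A _~_ x) ×
      (∀ y → Z A' _~'_ y → Σ Pt λ x → Z A _~_ x × B A' _~'_ (F x ⊕ (⊖ y)))

  Lim1DefIsoFil : (ℕ → Carrier → Set) → Set₁
  Lim1DefIsoFil A = DefinablyIsomorphic A _≈_ A (λ a b → a ≈[ A ]∞ b)

module Submission where

-- The definable isomorphism is induced by the identity of ∏_{m₀≤m₁} G,
-- which is Borel because congruence modulo A⁽∞⁾ is coarser than equality.
-- For the same reason it maps Z(𝑨) into Z(𝑨^fil) and B(𝑨) into B(𝑨^fil),
-- and it is trivially additive.  The content lies in two lemmas:
--   * injectivity: a cocycle x of 𝑨 that is a coboundary modulo A⁽∞⁾,
--     x₀ₘ ≡ z₀ − zₘ, is a coboundary of 𝑨, witnessed by z'ₘ = z₀ − x₀ₘ;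
--   * surjectivity: a cocycle y of 𝑨^fil agrees modulo A⁽∞⁾ with the
--     telescoping cocycle Sₘ₁ − Sₘ₀ of its partial sums
--     Sₙ = y₀₁ + y₁₂ + ⋯ + yₙ₋₁ₙ, which is a cocycle of 𝑨 on the nose.

open import Defs
open import Level using (0ℓ)
open import Data.Nat using (ℕ; zero; suc; _≤_; z≤n; _≤′_; ≤′-refl; ≤′-step)
open import Data.Nat.Properties using (≤-trans; ≤-irrelevant; n≤1+n; ≤⇒≤′; ≤′⇒≤)
open import Data.Product using (Σ; _×_; _,_)
open import Algebra.Bundles using (AbelianGroup)
open import Relation.Binary.Bundles using (Preorder)
open import Relation.Binary.PropositionalEquality using (subst)
import Algebra.Properties.AbelianGroup as AbelianGroupProperties
import Algebra.Properties.CommutativeSemigroup as CommutativeSemigroupProperties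
import Relation.Binary.Reasoning.Preorder as PreorderReasoning
import Relation.Binary.Reasoning.Setoid as SetoidReasoning

-- The identity of ∏_I C is Borel from a coordinate relation to any coarser
-- one: a set respecting the coarser relation respects the finer one.
identity-isBorelMap : {I C : Set} {_~_ _~'_ : C → C → Set} →
                      (∀ {a b} → a ~ b → a ~' b) →
                      IsBorelMap {I = I} {J = I} _~_ _~'_ (λ x → x)
identity-isBorelMap coarser j S S-respects =
  gen j S (λ a~b → S-respects (coarser a~b))

module Differences (G : AbelianGroup 0ℓ 0ℓ) where
  open AbelianGroup G
  open SetoidReasoning setoid

  difference-chain : ∀ a b c → (a ∙ b ⁻¹) ∙ (b ∙ c ⁻¹) ≈ a ∙ c ⁻¹
  difference-chain a b c = begin
    (a ∙ b ⁻¹) ∙ (b ∙ c ⁻¹)  ≈⟨ assoc a (b ⁻¹) (b ∙ c ⁻¹) ⟩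
    a ∙ (b ⁻¹ ∙ (b ∙ c ⁻¹))  ≈⟨ ∙-congˡ (assoc (b ⁻¹) b (c ⁻¹)) ⟨
    a ∙ ((b ⁻¹ ∙ b) ∙ c ⁻¹)  ≈⟨ ∙-congˡ (∙-congʳ (inverseˡ b)) ⟩
    a ∙ (ε ∙ c ⁻¹)           ≈⟨ ∙-congˡ (identityˡ (c ⁻¹)) ⟩
    a ∙ c ⁻¹                 ∎

  difference-cancel : ∀ c u v → (c ∙ u ⁻¹) ∙ (c ∙ v ⁻¹) ⁻¹ ≈ v ∙ u ⁻¹
  difference-cancel c u v = begin
    (c ∙ u ⁻¹) ∙ (c ∙ v ⁻¹) ⁻¹  ≈⟨ ∙-congˡ (⁻¹-anti-homo-// c v) ⟩
    (c ∙ u ⁻¹) ∙ (v ∙ c ⁻¹)     ≈⟨ comm (c ∙ u ⁻¹) (v ∙ c ⁻¹) ⟩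
    (v ∙ c ⁻¹) ∙ (c ∙ u ⁻¹)     ≈⟨ difference-chain v c u ⟩
    v ∙ u ⁻¹                    ∎
    where open AbelianGroupProperties G using (⁻¹-anti-homo-//)

-- It contains ≈,
-- is an equivalence compatible with the group operations, and is packaged
-- as a preorder over ≈ so that mixed ≈/~ chains can be written.
module CongruenceModulo (G : AbelianGroup 0ℓ 0ℓ) {K : AbelianGroup.Carrier G → Set}
                        (K-subgroup : IsSubgroup G K) where
  open AbelianGroup G
  open IsSubgroup K-subgroup
  open Differences G using (difference-chain)
  open AbelianGroupProperties G using (⁻¹-anti-homo-//; ⁻¹-∙-comm; x≈y⇒x∙y⁻¹≈ε; ε⁻¹≈ε; xyx⁻¹≈y)
  open CommutativeSemigroupProperties commutativeSemigroup using (interchange)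

  infix 4 _~_
  _~_ : Carrier → Carrier → Set
  a ~ b = K (a ∙ b ⁻¹)

  ≈⇒~ : ∀ {a b} → a ≈ b → a ~ b
  ≈⇒~ a≈b = resp (sym (x≈y⇒x∙y⁻¹≈ε a≈b)) has-ε

  ~-refl : ∀ {a} → a ~ a
  ~-refl = ≈⇒~ refl

  ~-sym : ∀ {a b} → a ~ b → b ~ a
  ~-sym {a} {b} a~b = resp (⁻¹-anti-homo-// a b) (⁻¹-cl a~b)

  ~-trans : ∀ {a b c} → a ~ b → b ~ c → a ~ c
  ~-trans {a} {b} {c} a~b b~c = resp (difference-chain a b c) (∙-cl a~b b~c)

  ~-preorder : Preorder 0ℓ 0ℓ 0ℓ
  ~-preorder = record
    { isPreorder = record
      { isEquivalence = isEquivalence ; reflexive = ≈⇒~ ; trans = ~-trans } }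

  open PreorderReasoning ~-preorder

  ~-∙-cong : ∀ {a b c d} → a ~ b → c ~ d → a ∙ c ~ b ∙ d
  ~-∙-cong {a} {b} {c} {d} a~b c~d = resp difference-of-sums (∙-cl a~b c~d)
    where
    difference-of-sums : (a ∙ b ⁻¹) ∙ (c ∙ d ⁻¹) ≈ (a ∙ c) ∙ (b ∙ d) ⁻¹
    difference-of-sums = begin-equality
      (a ∙ b ⁻¹) ∙ (c ∙ d ⁻¹)  ≈⟨ interchange a (b ⁻¹) c (d ⁻¹) ⟩
      (a ∙ c) ∙ (b ⁻¹ ∙ d ⁻¹)  ≈⟨ ∙-congˡ (⁻¹-∙-comm b d) ⟩
      (a ∙ c) ∙ (b ∙ d) ⁻¹     ∎

  ~-⁻¹-cong : ∀ {a b} → a ~ b → a ⁻¹ ~ b ⁻¹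
  ~-⁻¹-cong {a} {b} a~b = resp (sym (⁻¹-∙-comm a (b ⁻¹))) (⁻¹-cl a~b)

  ∈⇒~ε : ∀ {a} → K a → a ~ ε
  ∈⇒~ε {a} a∈K = resp (sym (trans (∙-congˡ ε⁻¹≈ε) (identityʳ a))) a∈K

  ~-absorb : ∀ {a b c} → K c → a ~ b ∙ c ⁻¹ → a ~ b
  ~-absorb {a} {b} {c} c∈K a~b-c = begin
    a          ≲⟨ a~b-c ⟩
    b ∙ c ⁻¹   ≲⟨ ~-∙-cong ~-refl (~-⁻¹-cong (∈⇒~ε c∈K)) ⟩
    b ∙ ε ⁻¹   ≈⟨ ∙-congˡ ε⁻¹≈ε ⟩
    b ∙ ε      ≈⟨ identityʳ b ⟩
    b          ∎

  ~-idempotent⇒~ε : ∀ {a} → a ~ a ∙ a → a ~ ε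
  ~-idempotent⇒~ε {a} a~a+a = ~-sym (begin
    ε               ≈⟨ inverseʳ a ⟨
    a ∙ a ⁻¹        ≲⟨ ~-∙-cong a~a+a ~-refl ⟩
    (a ∙ a) ∙ a ⁻¹  ≈⟨ xyx⁻¹≈y a a ⟩
    a               ∎)

  ~⇒difference~ε : ∀ {a b} → a ~ b → a ∙ b ⁻¹ ~ ε ∙ ε ⁻¹
  ~⇒difference~ε {a} {b} a~b = begin
    a ∙ b ⁻¹  ≲⟨ ~-∙-cong a~b ~-refl ⟩
    b ∙ b ⁻¹  ≈⟨ inverseʳ b ⟩
    ε         ≈⟨ inverseʳ ε ⟨
    ε ∙ ε ⁻¹  ∎

module Coarsening (G : AbelianGroup 0ℓ 0ℓ) (A : ℕ → AbelianGroup.Carrier G → Set)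
                  {_~_ _~'_ : AbelianGroup.Carrier G → AbelianGroup.Carrier G → Set}
                  (coarser : ∀ {a b} → a ~ b → a ~' b) where

  Z-coarsen : ∀ x → Z G A _~_ x → Z G A _~'_ x
  Z-coarsen x (x∈A , x-cocycle) = x∈A , λ p q → coarser (x-cocycle p q)

  B-coarsen : ∀ x → B G A _~_ x → B G A _~'_ x
  B-coarsen x (z , z∈A , x~δz) = z , z∈A , λ p → coarser (x~δz p)

module MonoTowerCohomology (G : AbelianGroup 0ℓ 0ℓ) (A : ℕ → AbelianGroup.Carrier G → Set)
                           (tower : IsMonoTower G A) where
  open AbelianGroup G
  open IsMonoTower tower

  antitone : ∀ {m n g} → m ≤′ n → A n g → A m g
  antitone ≤′-refl         g∈Aₙ = g∈Aₙ
  antitone (≤′-step m≤′n) g∈Aₙ = antitone m≤′n (decreasing _ g∈Aₙ)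

  A∞-subgroup : IsSubgroup G (A∞ G A)
  A∞-subgroup = record
    { resp  = λ a≈b a∈A∞ m → IsSubgroup.resp (subgroup m) a≈b (a∈A∞ m)
    ; has-ε = λ m → IsSubgroup.has-ε (subgroup m)
    ; ∙-cl  = λ a∈A∞ b∈A∞ m → IsSubgroup.∙-cl (subgroup m) (a∈A∞ m) (b∈A∞ m)
    ; ⁻¹-cl = λ a∈A∞ m → IsSubgroup.⁻¹-cl (subgroup m) (a∈A∞ m) }

  -- Congruence modulo A⁽∞⁾; its relation _~_ is _≈[ A ]∞_ by definition.
  open CongruenceModulo G A∞-subgroup public

  -- The cocycle identity, for arbitrary proofs of the three inequalities.
  cocycle : ∀ {_≃_ : Carrier → Carrier → Set} {x} → Z G A _≃_ x →
            ∀ {a b c} (p : a ≤ b) (q : b ≤ c) (r : a ≤ c) →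
            at G x r ≃ (at G x p ∙ at G x q)
  cocycle {_≃_} {x} (_ , x-cocycle) p q r =
    subst (λ s → at G x s ≃ (at G x p ∙ at G x q)) (≤-irrelevant (≤-trans p q) r)
          (x-cocycle p q)

  zero-coboundary : ∀ {_≃_ : Carrier → Carrier → Set} x →
                    (∀ {a b} (p : a ≤ b) → at G x p ≃ (ε ∙ ε ⁻¹)) → B G A _≃_ x
  zero-coboundary x x≃0 = (λ _ → ε) , (λ m → IsSubgroup.has-ε (subgroup m)) , x≃0

  -- x − x is a coboundary modulo A⁽∞⁾; this makes the identity additive.
  self-difference-coboundary : ∀ x → B G A _~_ (_⊕_ G x (⊖_ G x))
  self-difference-coboundary x = zero-coboundary {_~_} _ (λ p → ~⇒difference~ε ~-refl)

  -- From x₀ₘ ≡ z₀ − zₘ (mod A⁽∞⁾) and zₘ ∈ A⁽ᵐ⁾ one gets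
  -- z'ₘ = z₀ − x₀ₘ ∈ A⁽ᵐ⁾, and the cocycle identity gives x = δz'.
  coboundary-mod-A∞⇒coboundary : ∀ x → Z G A _≈_ x → B G A _~_ x → B G A _≈_ x
  coboundary-mod-A∞⇒coboundary x (_ , x-cocycle) (z , z∈A , x~δz) =
    z' , z'∈A , x≈δz'
    where
    open SetoidReasoning setoid
    open Differences G using (difference-cancel)
    open AbelianGroupProperties G using (xyx⁻¹≈y)

    x₀ : ℕ → Carrier
    x₀ m = at G x {0} {m} z≤n

    z' : ℕ → Carrier
    z' m = z 0 ∙ x₀ m ⁻¹

    z'∈A : ∀ m → A m (z' m)
    z'∈A m = Aₘ.~-sym (Aₘ.~-absorb (z∈A m) (x~δz z≤n m))
      where module Aₘ = CongruenceModulo G (subgroup m)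

    x≈δz' : ∀ {a b} (p : a ≤ b) → at G x p ≈ (z' a ∙ z' b ⁻¹)
    x≈δz' {a} {b} p = sym (begin
      z' a ∙ z' b ⁻¹               ≈⟨ difference-cancel (z 0) (x₀ a) (x₀ b) ⟩
      x₀ b ∙ x₀ a ⁻¹               ≈⟨ ∙-congʳ (x-cocycle z≤n p) ⟩
      (x₀ a ∙ at G x p) ∙ x₀ a ⁻¹  ≈⟨ xyx⁻¹≈y (x₀ a) (at G x p) ⟩
      at G x p                     ∎)

  module Telescope (y : Pt G) where
    partial-sum : ℕ → Carrier
    partial-sum zero    = ε
    partial-sum (suc n) = partial-sum n ∙ at G y (n≤1+n n)

    telescope : Pt G
    telescope ((a , b) , _) = partial-sum b ∙ partial-sum a ⁻¹

    partial-sum-step : ∀ a n → partial-sum (suc n) ∙ partial-sum a ⁻¹ ≈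
                               (partial-sum n ∙ partial-sum a ⁻¹) ∙ at G y (n≤1+n n)
    partial-sum-step a n = xy∙z≈xz∙y (partial-sum n) (at G y (n≤1+n n)) (partial-sum a ⁻¹)
      where open CommutativeSemigroupProperties commutativeSemigroup using (xy∙z≈xz∙y)

    telescope-cocycle : ∀ {a b c} (p : a ≤ b) (q : b ≤ c) →
                        at G telescope (≤-trans p q) ≈ (at G telescope p ∙ at G telescope q)
    telescope-cocycle {a} {b} {c} _ _ =
      sym (trans (comm _ _) (difference-chain (partial-sum c) (partial-sum b) (partial-sum a)))
      where open Differences G using (difference-chain)

    telescope-∈ : (∀ {a b} (p : a ≤ b) → A a (at G y p)) →
                  ∀ {a n} → a ≤′ n → A a (partial-sum n ∙ partial-sum a ⁻¹)
    telescope-∈ _ {a} ≤′-refl =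
      IsSubgroup.resp (subgroup a) (sym (inverseʳ (partial-sum a))) (IsSubgroup.has-ε (subgroup a))
    telescope-∈ y∈A {a} (≤′-step {n} a≤′n) =
      IsSubgroup.resp (subgroup a) (sym (partial-sum-step a n))
        (IsSubgroup.∙-cl (subgroup a) (telescope-∈ y∈A a≤′n)
                                      (antitone a≤′n (y∈A (n≤1+n n))))

    telescope~ : Z G A _~_ y → ∀ {a n} → a ≤′ n → (r : a ≤ n) →
                 partial-sum n ∙ partial-sum a ⁻¹ ~ at G y r
    telescope~ y-cocycle {a} ≤′-refl r = begin
      partial-sum a ∙ partial-sum a ⁻¹  ≈⟨ inverseʳ (partial-sum a) ⟩
      ε                                 ≲⟨ ~-sym (~-idempotent⇒~ε (cocycle {_~_} y-cocycle r r r)) ⟩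
      at G y r                          ∎
      where open PreorderReasoning ~-preorder
    telescope~ y-cocycle {a} (≤′-step {n} a≤′n) r = begin
      partial-sum (suc n) ∙ partial-sum a ⁻¹               ≈⟨ partial-sum-step a n ⟩
      (partial-sum n ∙ partial-sum a ⁻¹) ∙ at G y (n≤1+n n) ≲⟨ ~-∙-cong (telescope~ y-cocycle a≤′n a≤n) ~-refl ⟩
      at G y a≤n ∙ at G y (n≤1+n n)                         ≲⟨ ~-sym (cocycle {_~_} y-cocycle a≤n (n≤1+n n) r) ⟩
      at G y r                                              ∎
      where
      open PreorderReasoning ~-preorder
      a≤n : a ≤ n
      a≤n = ≤′⇒≤ a≤′n

  cocycle-mod-A∞⇒cocycle : ∀ y → Z G A _~_ y →
                           Σ (Pt G) λ x → Z G A _≈_ x × B G A _~_ (_⊕_ G x (⊖_ G y))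
  cocycle-mod-A∞⇒cocycle y y-cocycle@(y∈A , _) =
    telescope ,
    ((λ p → telescope-∈ y∈A (≤⇒≤′ p)) , telescope-cocycle) ,
    zero-coboundary {_~_} _ (λ p → ~⇒difference~ε (telescope~ y-cocycle (≤⇒≤′ p) p))
    where open Telescope y

lemma5p9 : (G : AbelianGroup 0ℓ 0ℓ) → Countable G →
           (A : ℕ → AbelianGroup.Carrier G → Set) → IsMonoTower G A →
           Lim1DefIsoFil G A
lemma5p9 G _ A tower =
  (λ x → x) ,
  identity-isBorelMap ≈⇒~ ,
  Z-coarsen ,
  (λ x y _ _ → B-coarsen (_⊕_ G x (⊖_ G y))) ,
  (λ x y _ _ → self-difference-coboundary (_⊕_ G x y)) ,
  coboundary-mod-A∞⇒coboundary ,
  cocycle-mod-A∞⇒cocycle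
  where
  open MonoTowerCohomology G A tower
  open Coarsening G A {AbelianGroup._≈_ G} {_~_} ≈⇒~
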